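{- If $S$ is a continuously searchable $\mathfrak S$-type, then the type $\mathbb N\to S$ of sequences in $S$ is continuously searchable.
   Context: $\mathfrak S$-types are defined inductively: every finite non-empty type is an $\mathfrak S$-type; if $S,S'$ are $\mathfrak S$-types then so is $S\times S'$; if $S$ is an $\mathfrak S$-type then so is $\mathbb N\to S$. The exactness type $E(S)$: $E(F)=\mathbf 1$ for finite $F$; $E(S\times S')=E(S)\times E(S')$; $E(\mathbb N\to S)=\mathbb N\times E(S)$. Equality with precision $p\in E(S)$, $x\equiv_p y$: for finite types iff $x=y$; for products componentwise; for sequences, $\alpha\equiv_{(m,p)}\beta$ iff $\alpha(i)\equiv_p\beta(i)$ for all $i<m$. A predicate $Q$ on $S$ is continuous if there is $q\in E(S)$ such that $x\equiv_q x'$ and $Q(x)$ imply $Q(x')$; it is detachable if it is decidable. A searcher on $S$ is a function $\mathscr E$ assigning to each detachable continuous predicate $Q$ on $S$ an element $\mathscr E(Q)\in S$ such that if some $x\in S$ satisfies $Q$ then $Q(\mathscr E(Q))$ holds. For predicates $P,Q$ on $S$ and $p\in E(S)$, $P\Leftrightarrow_p Q$ means that for all $x,x'$ with $x\equiv_p x'$, $P(x)$ holds iff $Q(x')$ holds. A searcher is continuous if $P\Leftrightarrow_p Q$ implies $\mathscr E(P)\equiv_p\mathscr E(Q)$ for all detachable continuous $P,Q$ and all $p$. An $\mathfrak S$-type is continuously searchable if it has a continuous searcher. -}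

module Defs where

open import Data.Nat using (ℕ; _<_)
open import Data.Fin using (Fin)
open import Data.Unit using (⊤)
open import Data.Product using (Σ; _×_; _,_; proj₁; proj₂)
open import Relation.Nullary using (Dec)
open import Relation.Binary.PropositionalEquality using (_≡_)

-- Codes for 𝔖-types (inductive definition).
-- A finite non-empty type is represented (up to bijection) by Fin (suc n).
data STy : Set where
  fin  : ℕ → STy
  _⊗_  : STy → STy → STy
  seqT : STy → STy

El : STy → Set
El (fin n)  = Fin (Data.Nat.suc n)
El (S ⊗ T)  = El S × El T
El (seqT S) = ℕ → El S

E : STy → Set
E (fin n)  = ⊤
E (S ⊗ T)  = E S × E T
E (seqT S) = ℕ × E S

Eqp : (S : STy) → E S → El S → El S → Set
Eqp (fin n)  p x y = x ≡ y
Eqp (S ⊗ T)  (p , q) (x , x') (y , y') = Eqp S p x y × Eqp T q x' y'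
Eqp (seqT S) (m , p) α β = ∀ i → i < m → Eqp S p (α i) (β i)

Continuous : (S : STy) → (El S → Set) → Set
Continuous S Q = Σ (E S) λ q → ∀ x x' → Eqp S q x x' → Q x → Q x'

Detachable : (S : STy) → (El S → Set) → Set
Detachable S Q = ∀ x → Dec (Q x)

record DCPred (S : STy) : Set₁ where
  field
    pred : El S → Set
    detachable : Detachable S pred
    continuous : Continuous S pred
open DCPred public

Equivp : (S : STy) → E S → (El S → Set) → (El S → Set) → Set
Equivp S p P Q = ∀ x x' → Eqp S p x x' → (P x → Q x') × (Q x' → P x)

IsSearcher : (S : STy) → (DCPred S → El S) → Set₁
IsSearcher S 𝓔 = (Q : DCPred S) → Σ (El S) (pred Q) → pred Q (𝓔 Q)

IsContinuousSearcher : (S : STy) → (DCPred S → El S) → Set₁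
IsContinuousSearcher S 𝓔 =
  (P Q : DCPred S) (p : E S) → Equivp S p (pred P) (pred Q) → Eqp S p (𝓔 P) (𝓔 Q)

ContinuouslySearchable : STy → Set₁
ContinuouslySearchable S =
  Σ (DCPred S → El S) λ 𝓔 → IsSearcher S 𝓔 × IsContinuousSearcher S 𝓔

-- A sequence is searched head first: at depth n + 1 the head is the 𝓔-search for an
-- x such that P holds of x followed by the depth-n search for the predicate
-- α ↦ P (x ∷ α), and at depth 0 a constant sequence is searched. If P only looks at
-- the first k entries, the depth-k search is a searcher by induction on k. Continuity
-- of 𝓔 propagates through the recursion, so at a fixed depth the search depends
-- continuously on the predicate; moreover, beyond the modulus of P the depth no longer
-- matters. Comparing two predicates at the larger of their moduli gives continuity.
module Submission where

open import Defs
open import Data.Nat as ℕ using (ℕ; zero; suc; _≤_; z≤n; _⊔_)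
open import Data.Nat.Properties
  using (≤-refl; <-≤-trans; m≤m⊔n; m≤n⊔m; pred-mono-≤; suc[m]≤n⇒m≤pred[n])
open import Data.Unit using (tt)
open import Data.Product using (Σ; _,_; proj₁; proj₂; swap)
open import Relation.Binary.PropositionalEquality as ≡ using ()

Eqp-refl : ∀ S p x → Eqp S p x x
Eqp-refl (fin n)  p       x       = ≡.refl
Eqp-refl (S ⊗ T)  (p , q) (x , y) = Eqp-refl S p x , Eqp-refl T q y
Eqp-refl (seqT S) (m , p) α       = λ i _ → Eqp-refl S p (α i)

Eqp-sym : ∀ S p x y → Eqp S p x y → Eqp S p y x
Eqp-sym (fin n)  p       x        y        e        = ≡.sym e
Eqp-sym (S ⊗ T)  (p , q) (x , x') (y , y') (e , e') = Eqp-sym S p x y e , Eqp-sym T q x' y' e'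
Eqp-sym (seqT S) (m , p) α        β        e        = λ i i<m → Eqp-sym S p (α i) (β i) (e i i<m)

Eqp-trans : ∀ S p x y z → Eqp S p x y → Eqp S p y z → Eqp S p x z
Eqp-trans (fin n)  p       x        y        z        e        f        = ≡.trans e f
Eqp-trans (S ⊗ T)  (p , q) (x , x') (y , y') (z , z') (e , e') (f , f') =
  Eqp-trans S p x y z e f , Eqp-trans T q x' y' z' e' f'
Eqp-trans (seqT S) (m , p) α β γ e f =
  λ i i<m → Eqp-trans S p (α i) (β i) (γ i) (e i i<m) (f i i<m)

Equivp-sym : ∀ S p P Q → Equivp S p P Q → Equivp S p Q P
Equivp-sym S p P Q P⇔Q x x' e = swap (P⇔Q x' x (Eqp-sym S p x x' e))

joinE : ∀ S → E S → E S → E S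
joinE (fin n)  p        q        = tt
joinE (S ⊗ T)  (p , p') (q , q') = joinE S p q , joinE T p' q'
joinE (seqT S) (m , p)  (n , q)  = m ⊔ n , joinE S p q

Eqp-joinˡ : ∀ S p q x y → Eqp S (joinE S p q) x y → Eqp S p x y
Eqp-joinˡ (fin n)  p        q        x        y        e        = e
Eqp-joinˡ (S ⊗ T)  (p , p') (q , q') (x , x') (y , y') (e , e') =
  Eqp-joinˡ S p q x y e , Eqp-joinˡ T p' q' x' y' e'
Eqp-joinˡ (seqT S) (m , p)  (n , q)  α β e =
  λ i i<m → Eqp-joinˡ S p q (α i) (β i) (e i (<-≤-trans i<m (m≤m⊔n m n)))

Eqp-joinʳ : ∀ S p q x y → Eqp S (joinE S p q) x y → Eqp S q x y
Eqp-joinʳ (fin n)  p        q        x        y        e        = e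
Eqp-joinʳ (S ⊗ T)  (p , p') (q , q') (x , x') (y , y') (e , e') =
  Eqp-joinʳ S p q x y e , Eqp-joinʳ T p' q' x' y' e'
Eqp-joinʳ (seqT S) (m , p)  (n , q)  α β e =
  λ i i<n → Eqp-joinʳ S p q (α i) (β i) (e i (<-≤-trans i<n (m≤n⊔m m n)))

module SequenceSearch (S : STy) (𝓔 : DCPred S → El S)
                      (𝓔-searches : IsSearcher S 𝓔) (𝓔-cong : IsContinuousSearcher S 𝓔) where

  _∷_ : El S → El (seqT S) → El (seqT S)
  (x ∷ α) zero    = x
  (x ∷ α) (suc i) = α i

  tail : El (seqT S) → El (seqT S)
  tail α i = α (suc i)

  ∷-cong : ∀ {k p x x' α β} → Eqp S p x x' → Eqp (seqT S) (ℕ.pred k , p) α β →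
           Eqp (seqT S) (k , p) (x ∷ α) (x' ∷ β)
  ∷-cong         x≈x' α≈β zero    _   = x≈x'
  ∷-cong {suc k} x≈x' α≈β (suc i) i<k = α≈β i (suc[m]≤n⇒m≤pred[n] i<k)

  ∷-η : ∀ q α → Eqp (seqT S) q α (α 0 ∷ tail α)
  ∷-η (m , p) α zero    _ = Eqp-refl S p (α 0)
  ∷-η (m , p) α (suc i) _ = Eqp-refl S p (α (suc i))

  HasModulus : ℕ → E S → DCPred (seqT S) → Set
  HasModulus k p P = ∀ α β → Eqp (seqT S) (k , p) α β → pred P α → pred P β

  modulus : DCPred (seqT S) → ℕ
  modulus P = proj₁ (proj₁ (continuous P))

  precision : DCPred (seqT S) → E S
  precision P = proj₂ (proj₁ (continuous P))

  continuity : ∀ P → HasModulus (modulus P) (precision P) P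
  continuity P = proj₂ (continuous P)

  Equivp-refl : ∀ P → Equivp (seqT S) (modulus P , precision P) (pred P) (pred P)
  Equivp-refl P α α' e =
    continuity P α α' e , continuity P α' α (Eqp-sym (seqT S) (modulus P , precision P) α α' e)

  withHead : DCPred (seqT S) → El S → DCPred (seqT S)
  withHead P x = record
    { pred       = λ α → pred P (x ∷ α)
    ; detachable = λ α → detachable P (x ∷ α)
    ; continuous = (ℕ.pred (modulus P) , precision P) , λ α β α≈β →
        continuity P (x ∷ α) (x ∷ β) (∷-cong (Eqp-refl S (precision P) x) α≈β)
    }

  onConstants : DCPred (seqT S) → DCPred S
  onConstants P = record
    { pred       = λ x → pred P (λ _ → x)
    ; detachable = λ x → detachable P (λ _ → x)
    ; continuous = precision P , λ x x' x≈x' → continuity P (λ _ → x) (λ _ → x') (λ _ _ → x≈x')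
    }

  withHead-HasModulus : ∀ {k p} P x → HasModulus k p P → HasModulus (ℕ.pred k) p (withHead P x)
  withHead-HasModulus {p = p} P x cont α β α≈β = cont (x ∷ α) (x ∷ β) (∷-cong (Eqp-refl S p x) α≈β)

  withHead-Equivp : ∀ {k p} P Q x x' → Equivp (seqT S) (k , p) (pred P) (pred Q) → Eqp S p x x' →
                    Equivp (seqT S) (ℕ.pred k , p) (pred (withHead P x)) (pred (withHead Q x'))
  withHead-Equivp P Q x x' P⇔Q x≈x' α α' α≈α' = P⇔Q (x ∷ α) (x' ∷ α') (∷-cong x≈x' α≈α')

  mutual
    search : ℕ → DCPred (seqT S) → El (seqT S)
    search zero    P = λ _ → 𝓔 (onConstants P)
    search (suc n) P = searchHead n P ∷ search n (withHead P (searchHead n P))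

    searchHead : ℕ → DCPred (seqT S) → El S
    searchHead n P = 𝓔 (headPredicate n P)

    headPredicate : ℕ → DCPred (seqT S) → DCPred S
    headPredicate n P = record
      { pred       = λ x → pred P (x ∷ search n (withHead P x))
      ; detachable = λ x → detachable P (x ∷ search n (withHead P x))
      ; continuous = precision P , headPredicate-continuous n P
      }

    headPredicate-continuous : ∀ n P x x' → Eqp S (precision P) x x' →
      pred P (x ∷ search n (withHead P x)) → pred P (x' ∷ search n (withHead P x'))
    headPredicate-continuous n P x x' x≈x' =
      continuity P _ _ (∷-cong x≈x' (search-cong n (withHead P x) (withHead P x') _ _
        (withHead-Equivp P P x x' (Equivp-refl P) x≈x')))

    search-cong : ∀ n P Q j r → Equivp (seqT S) (j , r) (pred P) (pred Q) →
                  Eqp (seqT S) (j , r) (search n P) (search n Q)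
    search-cong zero P Q j r P⇔Q i _ =
      𝓔-cong (onConstants P) (onConstants Q) r (λ x x' x≈x' → P⇔Q _ _ (λ _ _ → x≈x'))
    search-cong (suc n) P Q j r P⇔Q =
      ∷-cong {k = j} head≈ (search-cong n _ _ (ℕ.pred j) r (withHead-Equivp P Q _ _ P⇔Q head≈))
      where
      head≈ : Eqp S r (searchHead n P) (searchHead n Q)
      head≈ = searchHead-cong n P Q j r P⇔Q

    searchHead-cong : ∀ n P Q j r → Equivp (seqT S) (j , r) (pred P) (pred Q) →
                      Eqp S r (searchHead n P) (searchHead n Q)
    searchHead-cong n P Q j r P⇔Q = 𝓔-cong (headPredicate n P) (headPredicate n Q) r
      λ x x' x≈x' → P⇔Q _ _ (∷-cong {k = j} x≈x'
        (search-cong n (withHead P x) (withHead Q x') (ℕ.pred j) r (withHead-Equivp P Q x x' P⇔Q x≈x')))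

  search-correct : ∀ n {k p} P → HasModulus k p P → k ≤ n →
                   Σ (El (seqT S)) (pred P) → pred P (search n P)
  search-correct zero    P cont z≤n (α , Pα) = cont α _ (λ _ ()) Pα
  search-correct (suc n) {k} {p} P cont k≤1+n (α , Pα) =
    𝓔-searches (headPredicate n P) (α 0 , search-correct n (withHead P (α 0))
      (withHead-HasModulus P (α 0) cont) (pred-mono-≤ k≤1+n)
      (tail α , cont α _ (∷-η (k , p) α) Pα))

  search₀-stable : ∀ n {p} P Q → Equivp (seqT S) (0 , p) (pred P) (pred Q) →
                   ∀ i r → Eqp S r (search 0 P i) (search n Q i)
  search₀-stable zero    P Q P⇔Q i r =
    𝓔-cong (onConstants P) (onConstants Q) r (λ _ _ _ → P⇔Q _ _ (λ _ ()))
  search₀-stable (suc n) P Q P⇔Q zero r =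
    𝓔-cong (onConstants P) (headPredicate n Q) r (λ _ _ _ → P⇔Q _ _ (λ _ ()))
  search₀-stable (suc n) {p} P Q P⇔Q (suc i) r =
    search₀-stable n {p} P (withHead Q (searchHead n Q)) (λ _ _ _ → P⇔Q _ _ (λ _ ())) i r

  mutual
    search-stable : ∀ m n {k p} P Q → Equivp (seqT S) (k , p) (pred P) (pred Q) → k ≤ m → k ≤ n →
                    ∀ i r → Eqp S r (search m P i) (search n Q i)
    search-stable zero n P Q P⇔Q z≤n _ = search₀-stable n P Q P⇔Q
    search-stable (suc m) zero {p = p} P Q P⇔Q _ z≤n i r =
      Eqp-sym S r _ _ (search₀-stable (suc m) Q P (Equivp-sym (seqT S) (0 , p) _ _ P⇔Q) i r)
    search-stable (suc m) (suc n) P Q P⇔Q k≤1+m k≤1+n zero r =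
      searchHead-stable m n P Q P⇔Q k≤1+m k≤1+n r
    search-stable (suc m) (suc n) {p = p} P Q P⇔Q k≤1+m k≤1+n (suc i) r =
      search-stable m n _ _
        (withHead-Equivp P Q _ _ P⇔Q (searchHead-stable m n P Q P⇔Q k≤1+m k≤1+n p))
        (pred-mono-≤ k≤1+m) (pred-mono-≤ k≤1+n) i r

    -- 𝓔 is applied at the join of r and p: the r-part is the agreement sought, the
    -- p-part keeps the equivalence of the predicates on tails at precision p.
    searchHead-stable : ∀ m n {k p} P Q → Equivp (seqT S) (k , p) (pred P) (pred Q) →
                        k ≤ suc m → k ≤ suc n → ∀ r → Eqp S r (searchHead m P) (searchHead n Q)
    searchHead-stable m n {k} {p} P Q P⇔Q k≤1+m k≤1+n r =
      Eqp-joinˡ S r p _ _ (𝓔-cong (headPredicate m P) (headPredicate n Q) (joinE S r p)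
        λ x x' x≈x' → let x≈ₚx' = Eqp-joinʳ S r p x x' x≈x' in
          P⇔Q _ _ (∷-cong {k = k} x≈ₚx' λ i _ →
            search-stable m n (withHead P x) (withHead Q x')
              (withHead-Equivp P Q x x' P⇔Q x≈ₚx') (pred-mono-≤ k≤1+m) (pred-mono-≤ k≤1+n) i p))

  searchSeq : DCPred (seqT S) → El (seqT S)
  searchSeq P = search (modulus P) P

  searchSeq-isSearcher : IsSearcher (seqT S) searchSeq
  searchSeq-isSearcher P = search-correct (modulus P) P (continuity P) ≤-refl

  searchSeq-isContinuous : IsContinuousSearcher (seqT S) searchSeq
  searchSeq-isContinuous P Q (j , r) P⇔Q i i<j =
    Eqp-trans S r _ _ _ (Eqp-trans S r _ _ _ deepenP (search-cong depth P Q j r P⇔Q i i<j)) shallowQ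
    where
    depth : ℕ
    depth = modulus P ⊔ modulus Q
    deepenP : Eqp S r (searchSeq P i) (search depth P i)
    deepenP = search-stable (modulus P) depth P P (Equivp-refl P) ≤-refl (m≤m⊔n _ _) i r
    shallowQ : Eqp S r (search depth Q i) (searchSeq Q i)
    shallowQ = search-stable depth (modulus Q) Q Q (Equivp-refl Q) (m≤n⊔m _ _) ≤-refl i r

mainTheorem7 : (S : STy) → ContinuouslySearchable S → ContinuouslySearchable (seqT S)
mainTheorem7 S (𝓔 , 𝓔-searches , 𝓔-cong) = searchSeq , searchSeq-isSearcher , searchSeq-isContinuous
  where open SequenceSearch S 𝓔 𝓔-searches 𝓔-cong
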